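{- The graph $H_1$ defined below is not $3$-restrictly-choosable.
   Context: $W_2$ is the graph on the $21$ vertices $u,v,w,x_1,x_2,x_3,x_4,p_1,\dots,p_5,y_1,y_2,y_3,y_4,q_1,\dots,q_5$ with the following edges: the $5$-cycles $w x_1 x_2 x_3 x_4 w$, $p_1p_2p_3p_4p_5p_1$, $w y_1 y_2 y_3 y_4 w$, $q_1q_2q_3q_4q_5q_1$; the edges $wp_1, x_1p_2, x_2p_3, x_3p_4, x_4p_5$ and $wq_1, y_1q_2, y_2q_3, y_3q_4, y_4q_5$; the edges $uw, ux_2, uy_2$; and the edges $vx_2, vx_4, vy_2, vy_4$. The graph $H_1$ is obtained by taking $6$ pairwise disjoint copies of $W_2$, identifying all $6$ copies of $u$ into a single vertex and all $6$ copies of $v$ into a single vertex. For a function $f$ assigning positive integers to vertices, a graph $G=(V,E)$ is $f$-choosable if for every assignment of sets $S(z)\subseteq\mathbb{Z}$ with $|S(z)|=f(z)$ for all $z\in V$ there is a proper coloring $c$ with $c(z)\in S(z)$ for all $z$. $G$ is $k$-restrictly-choosable if $G$ is $f_x$-choosable for every $x\in V$, where $f_x(x)=k-1$ and $f_x(z)=k$ for all $z\in V\setminus\{x\}$. -}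

module Defs where

open import Data.Nat using (ℕ; _∸_)
open import Data.Integer using (ℤ)
open import Data.Fin using (Fin; zero; suc)
import Data.Fin.Properties as FinP
open import Data.List using (List; []; _∷_; length)
open import Data.List.Membership.Propositional using (_∈_)
open import Data.List.Relation.Unary.Unique.Propositional using (Unique)
open import Data.Product using (_×_; _,_; Σ; ∃; proj₁; proj₂)
open import Data.Bool using (if_then_else_)
open import Relation.Binary.Definitions using (DecidableEquality)
open import Relation.Binary.PropositionalEquality using (_≡_; _≢_; refl; cong)
open import Relation.Nullary using (¬_; does; yes; no)

-- Graphs: a vertex type (with decidable equality) and an edge relation.
-- Edges are undirected in effect: a proper colouring must give the two
-- endpoints of every edge different colours.

record Graph : Set₁ where
  field
    V    : Set
    _≟V_ : DecidableEquality V
    E    : V → V → Set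

open Graph public

IsListAssignment : (G : Graph) → (V G → ℕ) → (V G → List ℤ) → Set
IsListAssignment G f S = ∀ z → Unique (S z) × length (S z) ≡ f z

IsProperListColouring : (G : Graph) → (V G → List ℤ) → (V G → ℤ) → Set
IsProperListColouring G S c =
  (∀ z → c z ∈ S z) × (∀ a b → E G a b → c a ≢ c b)

Choosable : (G : Graph) → (V G → ℕ) → Set
Choosable G f = ∀ (S : V G → List ℤ) → IsListAssignment G f S →
  Σ (V G → ℤ) (λ c → IsProperListColouring G S c)

restrictFun : (G : Graph) → ℕ → V G → V G → ℕ
restrictFun G k x z = if does (_≟V_ G z x) then k ∸ 1 else k

RestrictlyChoosable : ℕ → Graph → Set
RestrictlyChoosable k G = ∀ (x : V G) → Choosable G (restrictFun G k x)

pattern w  = zero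
pattern x₁ = suc zero
pattern x₂ = suc (suc zero)
pattern x₃ = suc (suc (suc zero))
pattern x₄ = suc (suc (suc (suc zero)))
pattern p₁ = suc (suc (suc (suc (suc zero))))
pattern p₂ = suc (suc (suc (suc (suc (suc zero)))))
pattern p₃ = suc (suc (suc (suc (suc (suc (suc zero))))))
pattern p₄ = suc (suc (suc (suc (suc (suc (suc (suc zero)))))))
pattern p₅ = suc (suc (suc (suc (suc (suc (suc (suc (suc zero))))))))
pattern y₁ = suc (suc (suc (suc (suc (suc (suc (suc (suc (suc zero)))))))))
pattern y₂ = suc (suc (suc (suc (suc (suc (suc (suc (suc (suc (suc zero))))))))))
pattern y₃ = suc (suc (suc (suc (suc (suc (suc (suc (suc (suc (suc (suc zero)))))))))))
pattern y₄ = suc (suc (suc (suc (suc (suc (suc (suc (suc (suc (suc (suc (suc zero))))))))))))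
pattern q₁ = suc (suc (suc (suc (suc (suc (suc (suc (suc (suc (suc (suc (suc (suc zero)))))))))))))
pattern q₂ = suc (suc (suc (suc (suc (suc (suc (suc (suc (suc (suc (suc (suc (suc (suc zero))))))))))))))
pattern q₃ = suc (suc (suc (suc (suc (suc (suc (suc (suc (suc (suc (suc (suc (suc (suc (suc zero)))))))))))))))
pattern q₄ = suc (suc (suc (suc (suc (suc (suc (suc (suc (suc (suc (suc (suc (suc (suc (suc (suc zero))))))))))))))))
pattern q₅ = suc (suc (suc (suc (suc (suc (suc (suc (suc (suc (suc (suc (suc (suc (suc (suc (suc (suc zero)))))))))))))))))

data W₂V : Set where
  u v : W₂V
  core : Fin 19 → W₂V

W₂edges : List (W₂V × W₂V)
W₂edges =
  (core w , core x₁) ∷ (core x₁ , core x₂) ∷ (core x₂ , core x₃) ∷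
  (core x₃ , core x₄) ∷ (core x₄ , core w) ∷
  (core p₁ , core p₂) ∷ (core p₂ , core p₃) ∷ (core p₃ , core p₄) ∷
  (core p₄ , core p₅) ∷ (core p₅ , core p₁) ∷
  (core w , core y₁) ∷ (core y₁ , core y₂) ∷ (core y₂ , core y₃) ∷
  (core y₃ , core y₄) ∷ (core y₄ , core w) ∷
  (core q₁ , core q₂) ∷ (core q₂ , core q₃) ∷ (core q₃ , core q₄) ∷
  (core q₄ , core q₅) ∷ (core q₅ , core q₁) ∷
  (core w , core p₁) ∷ (core x₁ , core p₂) ∷ (core x₂ , core p₃) ∷
  (core x₃ , core p₄) ∷ (core x₄ , core p₅) ∷
  (core w , core q₁) ∷ (core y₁ , core q₂) ∷ (core y₂ , core q₃) ∷
  (core y₃ , core q₄) ∷ (core y₄ , core q₅) ∷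
  (u , core w) ∷ (u , core x₂) ∷ (u , core y₂) ∷
  (v , core x₂) ∷ (v , core x₄) ∷ (v , core y₂) ∷ (v , core y₄) ∷ []

-- H₁: six disjoint copies of W₂ with all copies of u identified and all
-- copies of v identified.

data H₁V : Set where
  hu hv : H₁V
  copy  : Fin 6 → Fin 19 → H₁V

embed : Fin 6 → W₂V → H₁V
embed i u        = hu
embed i v        = hv
embed i (core a) = copy i a

copy-inj₁ : ∀ {i j a b} → copy i a ≡ copy j b → i ≡ j
copy-inj₁ refl = refl

copy-inj₂ : ∀ {i j a b} → copy i a ≡ copy j b → a ≡ b
copy-inj₂ refl = refl

_≟H₁_ : DecidableEquality H₁V
hu ≟H₁ hu = yes refl
hu ≟H₁ hv = no (λ ())
hu ≟H₁ copy _ _ = no (λ ())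
hv ≟H₁ hu = no (λ ())
hv ≟H₁ hv = yes refl
hv ≟H₁ copy _ _ = no (λ ())
copy _ _ ≟H₁ hu = no (λ ())
copy _ _ ≟H₁ hv = no (λ ())
copy i a ≟H₁ copy j b with i FinP.≟ j | a FinP.≟ b
... | yes refl | yes refl = yes refl
... | no i≢j   | _        = no (λ e → i≢j (copy-inj₁ e))
... | yes _    | no a≢b   = no (λ e → a≢b (copy-inj₂ e))

H₁E : H₁V → H₁V → Set
H₁E a b = ∃ λ (i : Fin 6) → ∃ λ (e : W₂V × W₂V) →
  (e ∈ W₂edges) × (embed i (proj₁ e) ≡ a) × (embed i (proj₂ e) ≡ b)

H₁ : Graph
H₁ = record { V = H₁V ; _≟V_ = _≟H₁_ ; E = H₁E }

-- Restricting u to two colours leaves 2 · 3 = 6 possible colour pairs (a, b)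
-- for (u, v), one per copy of W₂, and copy i gets lists that kill the pair
-- assigned to it.  With u ↦ a and v ↦ b the lists force x₂ = 10, y₂ = 11 and
-- w ∈ {12, 13}.  If w = 12, then x₁ = 14, x₄ = 15, x₃ = 16, so every pᵢ is
-- blocked from its private colour and the odd cycle p₁…p₅ would have to be
-- 2-coloured from {17, 18}; symmetrically w = 13 blocks the cycle q₁…q₅.
-- The case analysis is done by a backtracking search, proved sound for any
-- finite graph: a proper list colouring yields a successful branch.
module Submission where

open import Defs
open import Data.Fin using (Fin; zero; suc)
import Data.Fin.Properties as Fin
open import Data.Integer using (ℤ; +_)
import Data.Integer as ℤ
open import Data.List using (List; []; _∷_; length)
open import Data.List.Membership.Propositional using (_∈_; lose)
open import Data.List.Relation.Unary.All as All using (All)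
open import Data.List.Relation.Unary.Any as Any using (Any; here; there)
open import Data.List.Relation.Unary.Unique.Propositional using (Unique)
open import Data.List.Relation.Unary.Unique.DecPropositional ℤ._≟_ using (unique?)
open import Data.Maybe using (Maybe; just; nothing)
import Data.Maybe.Properties as Maybe
import Data.Nat as ℕ
open import Data.Product using (_×_; _,_; ∃)
open import Data.Product.Properties using (≡-dec)
open import Data.Sum using (_⊎_; [_,_])
open import Data.Unit using (⊤; tt)
open import Function using (_∘_)
open import Relation.Binary.Definitions using (DecidableEquality)
open import Relation.Binary.PropositionalEquality using (_≡_; _≢_; refl; ≢-sym)
open import Relation.Nullary using (¬_; Dec; yes; no; ¬?)
open import Relation.Nullary.Decidable using (from-yes; _×-dec_; _⊎-dec_)

module Backtracking {A C : Set} (_≟A_ : DecidableEquality A) (_≟C_ : DecidableEquality C)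
                    (nbrs : A → List A) (L : A → List C) where

  Partial : Set
  Partial = A → Maybe C

  ∅ : Partial
  ∅ _ = nothing

  _[_↦_] : Partial → A → C → Partial
  (σ [ z ↦ c ]) y with y ≟A z
  ... | yes _ = just c
  ... | no  _ = σ y

  Fresh : Partial → A → C → Set
  Fresh σ z c = All (λ y → σ y ≢ just c) (nbrs z)

  fresh? : ∀ σ z c → Dec (Fresh σ z c)
  fresh? σ z c = All.all? (λ y → ¬? (Maybe.≡-dec _≟C_ (σ y) (just c))) (nbrs z)

  Extendable : List A → Partial → Set
  Extendable []       σ = ⊤
  Extendable (z ∷ zs) σ = Any (λ c → Fresh σ z c × Extendable zs (σ [ z ↦ c ])) (L z)

  extendable? : ∀ zs σ → Dec (Extendable zs σ)
  extendable? []       σ = yes tt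
  extendable? (z ∷ zs) σ = Any.any? (λ c → fresh? σ z c ×-dec extendable? zs (σ [ z ↦ c ])) (L z)

  _⊑_ : Partial → (A → C) → Set
  σ ⊑ col = ∀ y {c} → σ y ≡ just c → col y ≡ c

  ⊑-update : ∀ {σ col} z → σ ⊑ col → (σ [ z ↦ col z ]) ⊑ col
  ⊑-update z σ⊑col y with y ≟A z
  ... | yes refl = λ { refl → refl }
  ... | no  _    = σ⊑col y

  module _ {col : A → C} (col∈L : ∀ z → col z ∈ L z)
           (proper : ∀ z → All (λ y → col y ≢ col z) (nbrs z)) where

    fresh-below : ∀ {σ} → σ ⊑ col → ∀ z → Fresh σ z (col z)
    fresh-below σ⊑col z = All.map (λ {y} y≢z σy → y≢z (σ⊑col y σy)) (proper z)

    extendable-below : ∀ zs {σ} → σ ⊑ col → Extendable zs σ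
    extendable-below []       _      = tt
    extendable-below (z ∷ zs) σ⊑col  = lose (col∈L z)
      (fresh-below σ⊑col z , extendable-below zs (⊑-update z σ⊑col))

  no-colouring : ∀ zs → ¬ Extendable zs ∅ → (col : A → C) → (∀ z → col z ∈ L z) →
                 ¬ (∀ z → All (λ y → col y ≢ col z) (nbrs z))
  no-colouring zs stuck col col∈L proper = stuck (extendable-below col∈L proper zs (λ _ ()))

_≟W₂_ : DecidableEquality W₂V
u      ≟W₂ u      = yes refl
u      ≟W₂ v      = no λ ()
u      ≟W₂ core _ = no λ ()
v      ≟W₂ u      = no λ ()
v      ≟W₂ v      = yes refl
v      ≟W₂ core _ = no λ ()
core _ ≟W₂ u      = no λ ()
core _ ≟W₂ v      = no λ ()
core a ≟W₂ core b with a Fin.≟ b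
... | yes refl = yes refl
... | no  a≢b  = no λ { refl → a≢b refl }

nbrs : W₂V → List W₂V
nbrs u         = core w ∷ core x₂ ∷ core y₂ ∷ []
nbrs v         = core x₂ ∷ core x₄ ∷ core y₂ ∷ core y₄ ∷ []
nbrs (core w)  = core p₁ ∷ core q₁ ∷ u ∷ core x₁ ∷ core x₄ ∷ core y₁ ∷ core y₄ ∷ []
nbrs (core x₁) = core p₂ ∷ core w ∷ core x₂ ∷ []
nbrs (core x₂) = core p₃ ∷ u ∷ v ∷ core x₁ ∷ core x₃ ∷ []
nbrs (core x₃) = core p₄ ∷ core x₂ ∷ core x₄ ∷ []
nbrs (core x₄) = core p₅ ∷ v ∷ core w ∷ core x₃ ∷ []
nbrs (core p₁) = core p₂ ∷ core p₅ ∷ core w ∷ []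
nbrs (core p₂) = core p₁ ∷ core p₃ ∷ core x₁ ∷ []
nbrs (core p₃) = core p₂ ∷ core p₄ ∷ core x₂ ∷ []
nbrs (core p₄) = core p₃ ∷ core p₅ ∷ core x₃ ∷ []
nbrs (core p₅) = core p₁ ∷ core p₄ ∷ core x₄ ∷ []
nbrs (core y₁) = core q₂ ∷ core w ∷ core y₂ ∷ []
nbrs (core y₂) = core q₃ ∷ u ∷ v ∷ core y₁ ∷ core y₃ ∷ []
nbrs (core y₃) = core q₄ ∷ core y₂ ∷ core y₄ ∷ []
nbrs (core y₄) = core q₅ ∷ v ∷ core w ∷ core y₃ ∷ []
nbrs (core q₁) = core q₂ ∷ core q₅ ∷ core w ∷ []
nbrs (core q₂) = core q₁ ∷ core q₃ ∷ core y₁ ∷ []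
nbrs (core q₃) = core q₂ ∷ core q₄ ∷ core y₂ ∷ []
nbrs (core q₄) = core q₃ ∷ core q₅ ∷ core y₃ ∷ []
nbrs (core q₅) = core q₁ ∷ core q₄ ∷ core y₄ ∷ []

Adjacent : W₂V → W₂V → Set
Adjacent y z = (y , z) ∈ W₂edges ⊎ (z , y) ∈ W₂edges

adjacent-to? : ∀ z → Dec (All (λ y → Adjacent y z) (nbrs z))
adjacent-to? z = All.all? (λ y → ((y , z) ∈? W₂edges) ⊎-dec ((z , y) ∈? W₂edges)) (nbrs z)
  where open import Data.List.Membership.DecPropositional (≡-dec _≟W₂_ _≟W₂_) using (_∈?_)

nbrs-adjacent : ∀ z → All (λ y → Adjacent y z) (nbrs z)
nbrs-adjacent u        = from-yes (adjacent-to? u)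
nbrs-adjacent v        = from-yes (adjacent-to? v)
nbrs-adjacent (core k) = from-yes (Fin.all? λ k → adjacent-to? (core k)) k

proper-on-nbrs : ∀ {col : W₂V → ℤ} → (∀ {p q} → (p , q) ∈ W₂edges → col p ≢ col q) →
                 ∀ z → All (λ y → col y ≢ col z) (nbrs z)
proper-on-nbrs proper z = All.map [ proper , (λ e → ≢-sym (proper e)) ] (nbrs-adjacent z)

-- Colours 10–23 are private to the copy; only a and b are shared with u and v.
coreLists : ℤ × ℤ → Fin 19 → List ℤ
coreLists (a , b) w  = a    ∷ + 12 ∷ + 13 ∷ []
coreLists (a , b) x₁ = + 12 ∷ + 10 ∷ + 14 ∷ []
coreLists (a , b) x₂ = a    ∷ b    ∷ + 10 ∷ []
coreLists (a , b) x₃ = + 10 ∷ + 15 ∷ + 16 ∷ []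
coreLists (a , b) x₄ = b    ∷ + 12 ∷ + 15 ∷ []
coreLists (a , b) p₁ = + 12 ∷ + 17 ∷ + 18 ∷ []
coreLists (a , b) p₂ = + 14 ∷ + 17 ∷ + 18 ∷ []
coreLists (a , b) p₃ = + 10 ∷ + 17 ∷ + 18 ∷ []
coreLists (a , b) p₄ = + 16 ∷ + 17 ∷ + 18 ∷ []
coreLists (a , b) p₅ = + 15 ∷ + 17 ∷ + 18 ∷ []
coreLists (a , b) y₁ = + 13 ∷ + 11 ∷ + 19 ∷ []
coreLists (a , b) y₂ = a    ∷ b    ∷ + 11 ∷ []
coreLists (a , b) y₃ = + 11 ∷ + 20 ∷ + 21 ∷ []
coreLists (a , b) y₄ = b    ∷ + 13 ∷ + 20 ∷ []
coreLists (a , b) q₁ = + 13 ∷ + 22 ∷ + 23 ∷ []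
coreLists (a , b) q₂ = + 19 ∷ + 22 ∷ + 23 ∷ []
coreLists (a , b) q₃ = + 11 ∷ + 22 ∷ + 23 ∷ []
coreLists (a , b) q₄ = + 21 ∷ + 22 ∷ + 23 ∷ []
coreLists (a , b) q₅ = + 20 ∷ + 22 ∷ + 23 ∷ []

W₂Lists : ℤ × ℤ → W₂V → List ℤ
W₂Lists (a , b) u        = a ∷ []
W₂Lists (a , b) v        = b ∷ []
W₂Lists ab      (core k) = coreLists ab k

pinned : Fin 6 → ℤ × ℤ
pinned zero                               = + 1 , + 3
pinned (suc zero)                         = + 1 , + 4
pinned (suc (suc zero))                   = + 1 , + 5
pinned (suc (suc (suc zero)))             = + 2 , + 3
pinned (suc (suc (suc (suc zero))))       = + 2 , + 4
pinned (suc (suc (suc (suc (suc zero))))) = + 2 , + 5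

module W₂Search (ab : ℤ × ℤ) = Backtracking _≟W₂_ ℤ._≟_ nbrs (W₂Lists ab)

-- Colouring u, v and the then forced x₂, y₂ first keeps the search tree small.
searchOrder : List W₂V
searchOrder = u ∷ v ∷ core x₂ ∷ core y₂ ∷ core w ∷ core x₁ ∷ core x₄ ∷ core x₃ ∷
  core p₁ ∷ core p₂ ∷ core p₃ ∷ core p₄ ∷ core p₅ ∷
  core y₁ ∷ core y₄ ∷ core y₃ ∷ core q₁ ∷ core q₂ ∷ core q₃ ∷ core q₄ ∷ core q₅ ∷ []

W₂-pinned-uncolourable : ∀ i (col : W₂V → ℤ) → (∀ z → col z ∈ W₂Lists (pinned i) z) →
  ¬ (∀ {p q} → (p , q) ∈ W₂edges → col p ≢ col q)
W₂-pinned-uncolourable i col col∈L proper =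
  W₂Search.no-colouring (pinned i) searchOrder (stuck i) col col∈L (proper-on-nbrs proper)
  where
  stuck : ∀ i → ¬ W₂Search.Extendable (pinned i) searchOrder (W₂Search.∅ (pinned i))
  stuck = from-yes (Fin.all? λ i →
    ¬? (W₂Search.extendable? (pinned i) searchOrder (W₂Search.∅ (pinned i))))

H₁Lists : H₁V → List ℤ
H₁Lists hu         = + 1 ∷ + 2 ∷ []
H₁Lists hv         = + 3 ∷ + 4 ∷ + 5 ∷ []
H₁Lists (copy i k) = coreLists (pinned i) k

pinned-covers : ∀ {a b} → a ∈ H₁Lists hu → b ∈ H₁Lists hv → ∃ λ i → pinned i ≡ (a , b)
pinned-covers (here refl)         (here refl)                 = zero , refl
pinned-covers (here refl)         (there (here refl))         = suc zero , refl
pinned-covers (here refl)         (there (there (here refl))) = suc (suc zero) , refl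
pinned-covers (there (here refl)) (here refl)                 = suc (suc (suc zero)) , refl
pinned-covers (there (here refl)) (there (here refl))         = suc (suc (suc (suc zero))) , refl
pinned-covers (there (here refl)) (there (there (here refl))) = suc (suc (suc (suc (suc zero)))) , refl

valid-at? : ∀ z → Dec (Unique (H₁Lists z) × length (H₁Lists z) ≡ restrictFun H₁ 3 hu z)
valid-at? z = unique? (H₁Lists z) ×-dec (length (H₁Lists z) ℕ.≟ restrictFun H₁ 3 hu z)

H₁Lists-valid : IsListAssignment H₁ (restrictFun H₁ 3 hu) H₁Lists
H₁Lists-valid hu         = from-yes (valid-at? hu)
H₁Lists-valid hv         = from-yes (valid-at? hv)
H₁Lists-valid (copy i k) = from-yes (Fin.all? λ i → Fin.all? λ k → valid-at? (copy i k)) i k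

H₁Lists-uncolourable : ∀ (c : H₁V → ℤ) → ¬ IsProperListColouring H₁ H₁Lists c
H₁Lists-uncolourable c (c∈S , proper) with pinned-covers (c∈S hu) (c∈S hv)
... | i , pinned≡ = W₂-pinned-uncolourable i (c ∘ embed i) col∈L
  (λ {p} {q} pq → proper _ _ (i , (p , q) , pq , refl , refl))
  where
  col∈L : ∀ z → c (embed i z) ∈ W₂Lists (pinned i) z
  col∈L u        rewrite pinned≡ = here refl
  col∈L v        rewrite pinned≡ = here refl
  col∈L (core k) = c∈S (copy i k)

lemma4p5 : ¬ RestrictlyChoosable 3 H₁
lemma4p5 rc = let c , colouring = rc hu H₁Lists H₁Lists-valid in H₁Lists-uncolourable c colouring
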